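{- Let $k\geq1$ be an integer and let $G$ be a graph of order $n$ and size $m$ with $\delta(G)\geq k-1$. Then $$d_{\times k}(G)\leq\frac12+\sqrt{\frac14+\frac{2m-(k-1)n}{k\,\gamma_{\times k}(G)}}.$$ Moreover, equality holds if and only if $G\in\Psi$.
   Context: For a graph $G$ with $\delta(G)\geq k-1$, a $k$-tuple dominating set is a set $S\subseteq V(G)$ with $|N[v]\cap S|\geq k$ for all $v\in V(G)$ ($N[v]$ the closed neighborhood); $\gamma_{\times k}(G)$ is its minimum cardinality. A $k$-tuple domatic partition is a partition of $V(G)$ each of whose parts is a $k$-tuple dominating set; $d_{\times k}(G)$ is the maximum number of parts of such a partition. The family $\Psi$: take $(k-1)$-regular graphs $H_1,\dots,H_r$ all of the same order, and form $G$ from their disjoint union by joining each vertex of $H_i$ to precisely $k$ vertices of $H_j$, for all $1\leq i\neq j\leq r$; $\Psi$ is the family of all such graphs $G$. -}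

module Defs where

open import Data.Nat using (ℕ; _+_; _*_; _∸_; _≤_)
open import Data.Bool using (Bool; true; false; _∨_)
open import Data.Fin using (Fin)
open import Data.Fin.Properties using (_≟_; _<?_)
open import Data.Fin.Subset using (Subset; _∩_; ∣_∣)
open import Data.Vec using (tabulate)
open import Data.List using (allFin; map)
open import Data.Nat.ListAction using (sum)
open import Data.Product using (Σ; _×_; ∃; ∃-syntax)
open import Relation.Nullary using (¬_)
open import Relation.Nullary.Decidable using (⌊_⌋)
open import Relation.Binary.PropositionalEquality using (_≡_)

record Graph (n : ℕ) : Set where
  field
    Adj    : Fin n → Fin n → Bool
    sym    : ∀ i j → Adj i j ≡ Adj j i
    irrefl : ∀ i → Adj i i ≡ false
open Graph public

module _ {n : ℕ} (G : Graph n) where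

  N : Fin n → Subset n
  N v = tabulate (λ u → Adj G v u)

  N[_] : Fin n → Subset n
  N[ v ] = tabulate (λ u → Adj G v u ∨ ⌊ v ≟ u ⌋)

  deg : Fin n → ℕ
  deg v = ∣ N v ∣

  size : ℕ
  size = sum (map (λ v → ∣ N v ∩ tabulate (λ u → ⌊ v <? u ⌋) ∣) (allFin n))

  MinDegAtLeast : ℕ → Set
  MinDegAtLeast d = ∀ v → d ≤ deg v

  IsKTupleDom : ℕ → Subset n → Set
  IsKTupleDom k S = ∀ v → k ≤ ∣ N[ v ] ∩ S ∣

  IsKTupleDomNumber : ℕ → ℕ → Set
  IsKTupleDomNumber k g =
    (Σ (Subset n) λ S → IsKTupleDom k S × ∣ S ∣ ≡ g)
    × (∀ S → IsKTupleDom k S → g ≤ ∣ S ∣)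

  class : {r : ℕ} → (Fin n → Fin r) → Fin r → Subset n
  class c i = tabulate (λ u → ⌊ c u ≟ i ⌋)

  IsKTupleDomaticPartition : ℕ → (d : ℕ) → (Fin n → Fin d) → Set
  IsKTupleDomaticPartition k d c = ∀ i → IsKTupleDom k (class c i)

  IsKTupleDomaticNumber : ℕ → ℕ → Set
  IsKTupleDomaticNumber k d =
    (Σ (Fin n → Fin d) λ c → IsKTupleDomaticPartition k d c)
    × (∀ d' → (c : Fin n → Fin d') → IsKTupleDomaticPartition k d' c → d' ≤ d)

  -- G ∈ Ψ : V(G) splits into r parts H_1..H_r of equal order p, each inducing a
  -- (k-1)-regular graph, and every vertex of H_i has exactly k neighbours in H_j (j ≠ i).
  InPsi : ℕ → Set
  InPsi k =
    ∃[ r ] Σ (Fin n → Fin r) λ c → ∃[ p ]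
      (∀ i → ∣ class c i ∣ ≡ p)
      × (∀ v → ∣ N v ∩ class c (c v) ∣ ≡ k ∸ 1)
      × (∀ v j → ¬ (j ≡ c v) → ∣ N v ∩ class c j ∣ ≡ k)

{-# OPTIONS --safe #-}
module Submission where

-- Let c be a k-tuple domatic partition into d parts. Every closed neighbourhood meets each part
-- in at least k vertices, so |N[v]| ≥ dk and, summing over v, 2m + n ≥ ndk; every part is a
-- k-tuple dominating set, so n ≥ dγ. Hence kγd(d−1) + (k−1)n ≤ kn(d−1) + (k−1)n = ndk − n ≤ 2m.
-- Equality forces |N[v] ∩ V_i| = k for all v and i and, unless d = 1, all parts of size γ, which
-- is exactly membership in Ψ. Conversely, for G ∈ Ψ with parts H_1, …, H_r of order p the H_i
-- form a k-tuple domatic partition of the (rk − 1)-regular graph G, so d = r, and double counting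
-- Σ_v |N[v] ∩ S| = rk|S| ≥ nk for a k-tuple dominating set S gives γ = p.

open import Defs hiding (sym)
open import Data.Bool using (Bool; true; false; _∧_; _∨_)
open import Data.Fin using (Fin; zero; suc; fromℕ<)
open import Data.Fin.Properties using (_≟_; _<?_; <-cmp; <-asym; ¬Fin0)
open import Data.Fin.Subset using (Subset; _∩_; ∣_∣; ⊤)
open import Data.Fin.Subset.Properties using (∩-identityˡ; ∩-identityʳ; ∣⊤∣≡n)
import Data.List as List
open import Data.List.Properties using (map-tabulate)
import Data.Nat.ListAction as ListAction
open import Data.Nat using (ℕ; zero; suc; _+_; _*_; _∸_; _≤_; z≤n; NonZero)
open import Data.Nat.Properties
  using ( +-comm; +-identityʳ; *-comm; *-assoc; *-identityʳ; *-zeroʳ; *-distribʳ-+; +-*-semiring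
        ; ≤-reflexive; ≤-trans; ≤-antisym; +-mono-≤; +-monoˡ-≤; +-monoʳ-≤; *-monoˡ-≤; *-monoʳ-≤
        ; +-cancelʳ-≡; +-cancelˡ-≤; +-cancelʳ-≤; *-cancelˡ-≡; *-cancelʳ-≡; *-cancelʳ-≤
        ; module ≤-Reasoning )
open import Data.Nat.Solver using (module +-*-Solver)
open import Data.Product using (Σ; _×_; _,_; ∃-syntax)
open import Data.Sum using (_⊎_; inj₁; inj₂)
open import Data.Vec using ([]; _∷_; lookup; tabulate)
open import Data.Vec.Properties using (lookup∘tabulate; lookup-zipWith; lookup-replicate)
open import Function using (_∘_; id)
open import Function.Bundles using (_⇔_; mk⇔; Equivalence)
open import Relation.Binary using (tri<; tri≈; tri>)
open import Relation.Binary.PropositionalEquality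
open import Relation.Nullary using (¬_; yes; no; contradiction)
open import Relation.Nullary.Decidable using (⌊_⌋)

open import Algebra.Properties.Semiring.Sum +-*-semiring
  using (sum-syntax; sum-cong-≗; sum-replicate-zero; ∑-comm; ∑-distrib-+; *-distribˡ-sum; *-distribʳ-sum)
open +-*-Solver using (solve; _:+_; _:*_; _:=_; con)

𝟙 : Bool → ℕ
𝟙 true  = 1
𝟙 false = 0

𝟙-∧ : ∀ a b → 𝟙 (a ∧ b) ≡ 𝟙 a * 𝟙 b
𝟙-∧ true  b = sym (+-identityʳ (𝟙 b))
𝟙-∧ false b = refl

δ : ∀ {n} → Fin n → Fin n → ℕ
δ v u = 𝟙 ⌊ v ≟ u ⌋

δ-sym : ∀ {n} (v u : Fin n) → δ v u ≡ δ u v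
δ-sym v u with v ≟ u | u ≟ v
... | yes _  | yes _  = refl
... | no _   | no _   = refl
... | yes eq | no neq = contradiction (sym eq) neq
... | no neq | yes eq = contradiction (sym eq) neq

-- Not definitional: ⌊_⌋ is isYes, which is stuck on the map′ in the suc case of Fin's _≟_.
δ-suc : ∀ {n} (v u : Fin n) → δ (suc v) (suc u) ≡ δ v u
δ-suc v u with v ≟ u
... | yes _ = refl
... | no _  = refl

δ-refl : ∀ {n} (v : Fin n) → δ v v ≡ 1
δ-refl v with v ≟ v
... | yes _   = refl
... | no v≢v = contradiction refl v≢v

δ-≢ : ∀ {n} {v u : Fin n} → ¬ v ≡ u → δ v u ≡ 0
δ-≢ {v = v} {u} v≢u with v ≟ u
... | yes v≡u = contradiction v≡u v≢u
... | no _    = refl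

∑-const : ∀ n x → ∑[ i < n ] x ≡ n * x
∑-const zero    x = refl
∑-const (suc n) x = cong (x +_) (∑-const n x)

∑-δ : ∀ {n} (v : Fin n) (h : Fin n → ℕ) → ∑[ u < n ] (δ v u * h u) ≡ h v
∑-δ {suc n} zero    h = trans (cong₂ _+_ (+-identityʳ (h zero)) (sum-replicate-zero n)) (+-identityʳ (h zero))
∑-δ {suc n} (suc v) h = trans (sum-cong-≗ (λ u → cong (_* h (suc u)) (δ-suc v u))) (∑-δ v (h ∘ suc))

∑-δ₁ : ∀ {n} (v : Fin n) → ∑[ u < n ] δ v u ≡ 1
∑-δ₁ v = trans (sum-cong-≗ (λ u → sym (*-identityʳ (δ v u)))) (∑-δ v (λ _ → 1))

∑-mono-≤ : ∀ {n} {f g : Fin n → ℕ} → (∀ i → f i ≤ g i) → ∑[ i < n ] f i ≤ ∑[ i < n ] g i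
∑-mono-≤ {zero}  f≤g = z≤n
∑-mono-≤ {suc n} f≤g = +-mono-≤ (f≤g zero) (∑-mono-≤ (f≤g ∘ suc))

f≤g∧∑g≤∑f⇒f≗g : ∀ {n} {f g : Fin n → ℕ} → (∀ i → f i ≤ g i) →
                 ∑[ i < n ] g i ≤ ∑[ i < n ] f i → ∀ i → f i ≡ g i
f≤g∧∑g≤∑f⇒f≗g {suc n} {f} {g} f≤g ∑g≤∑f zero    = ≤-antisym (f≤g zero) g₀≤f₀
  where
  g₀≤f₀ : g zero ≤ f zero
  g₀≤f₀ = +-cancelʳ-≤ _ _ _ (≤-trans ∑g≤∑f (+-monoʳ-≤ (f zero) (∑-mono-≤ (f≤g ∘ suc))))
f≤g∧∑g≤∑f⇒f≗g {suc n} {f} {g} f≤g ∑g≤∑f (suc i) = f≤g∧∑g≤∑f⇒f≗g (f≤g ∘ suc) ∑g′≤∑f′ i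
  where
  ∑g′≤∑f′ : ∑[ j < n ] g (suc j) ≤ ∑[ j < n ] f (suc j)
  ∑g′≤∑f′ = +-cancelˡ-≤ (g zero) _ _ (≤-trans ∑g≤∑f (+-monoˡ-≤ _ (f≤g zero)))

sum-tabulate : ∀ {n} (h : Fin n → ℕ) → ListAction.sum (List.tabulate h) ≡ ∑[ i < n ] h i
sum-tabulate {zero}  h = refl
sum-tabulate {suc n} h = cong (h zero +_) (sum-tabulate (h ∘ suc))

∣p∣≡∑ : ∀ {n} (p : Subset n) → ∣ p ∣ ≡ ∑[ u < n ] 𝟙 (lookup p u)
∣p∣≡∑ []        = refl
∣p∣≡∑ (true ∷ p)  = cong suc (∣p∣≡∑ p)
∣p∣≡∑ (false ∷ p) = ∣p∣≡∑ p

∣p∩q∣≡∑ : ∀ {n} (p q : Subset n) → ∣ p ∩ q ∣ ≡ ∑[ u < n ] (𝟙 (lookup p u) * 𝟙 (lookup q u))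
∣p∩q∣≡∑ p q = trans (∣p∣≡∑ (p ∩ q)) (sum-cong-≗ λ u → trans (cong 𝟙 (lookup-zipWith _∧_ u p q)) (𝟙-∧ (lookup p u) (lookup q u)))

m*o≡n*o⇒o≡0∨m≡n : ∀ m n o → m * o ≡ n * o → o ≡ 0 ⊎ m ≡ n
m*o≡n*o⇒o≡0∨m≡n m n zero    _  = inj₁ refl
m*o≡n*o⇒o≡0∨m≡n m n (suc o) eq = inj₂ (*-cancelʳ-≡ m n (suc o) eq)

bound : ℕ → ℕ → ℕ → ℕ → ℕ
bound k n γ d = k * γ * (d * (d ∸ 1)) + (k ∸ 1) * n

bound+n≡ : ∀ k' d' γ n → bound (suc k') n γ (suc d') + n ≡ suc k' * (suc d' * γ * d' + n)
bound+n≡ = solve 4 (λ k' d' γ n → (con 1 :+ k') :* γ :* ((con 1 :+ d') :* d') :+ k' :* n :+ n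
                                 := (con 1 :+ k') :* ((con 1 :+ d') :* γ :* d' :+ n)) refl

n*[d*k]≡ : ∀ k' d' n → n * (suc d' * suc k') ≡ suc k' * (n * d' + n)
n*[d*k]≡ = solve 3 (λ k' d' n → n :* ((con 1 :+ d') :* (con 1 :+ k')) := (con 1 :+ k') :* (n :* d' :+ n)) refl

bound+n≤n*[d*k] : ∀ k' d' γ n → suc d' * γ ≤ n → bound (suc k') n γ (suc d') + n ≤ n * (suc d' * suc k')
bound+n≤n*[d*k] k' d' γ n d*γ≤n = begin
  bound (suc k') n γ (suc d') + n          ≡⟨ bound+n≡ k' d' γ n ⟩
  suc k' * (suc d' * γ * d' + n)           ≤⟨ *-monoʳ-≤ (suc k') (+-monoˡ-≤ n (*-monoˡ-≤ d' d*γ≤n)) ⟩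
  suc k' * (n * d' + n)                    ≡⟨ n*[d*k]≡ k' d' n ⟨
  n * (suc d' * suc k')                    ∎
  where open ≤-Reasoning

d*γ≡n⇒bound+n≡n*[d*k] : ∀ k' d' γ n → suc d' * γ ≡ n → bound (suc k') n γ (suc d') + n ≡ n * (suc d' * suc k')
d*γ≡n⇒bound+n≡n*[d*k] k' d' γ n d*γ≡n = begin
  bound (suc k') n γ (suc d') + n          ≡⟨ bound+n≡ k' d' γ n ⟩
  suc k' * (suc d' * γ * d' + n)           ≡⟨ cong (λ x → suc k' * (x * d' + n)) d*γ≡n ⟩
  suc k' * (n * d' + n)                    ≡⟨ n*[d*k]≡ k' d' n ⟨
  n * (suc d' * suc k')                    ∎
  where open ≡-Reasoning

bound≤m : ∀ k' d' γ n m → suc d' * γ ≤ n → n * (suc d' * suc k') ≤ m + n →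
          bound (suc k') n γ (suc d') ≤ m
bound≤m k' d' γ n m d*γ≤n n*[d*k]≤m+n = +-cancelʳ-≤ n _ _ (≤-trans (bound+n≤n*[d*k] k' d' γ n d*γ≤n) n*[d*k]≤m+n)

bound≡m⇒tight : ∀ k' d' γ n m → suc d' * γ ≤ n → n * (suc d' * suc k') ≤ m + n →
                bound (suc k') n γ (suc d') ≡ m →
                n * (suc d' * suc k') ≡ m + n × (d' ≡ 0 ⊎ suc d' * γ ≡ n)
bound≡m⇒tight k' d' γ n m d*γ≤n n*[d*k]≤m+n bound≡m =
  n*[d*k]≡m+n , m*o≡n*o⇒o≡0∨m≡n (suc d' * γ) n d' d*γ*d'≡n*d'
  where
  n*[d*k]≡m+n : n * (suc d' * suc k') ≡ m + n
  n*[d*k]≡m+n = ≤-antisym n*[d*k]≤m+n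
    (subst (_≤ n * (suc d' * suc k')) (cong (_+ n) bound≡m) (bound+n≤n*[d*k] k' d' γ n d*γ≤n))
  d*γ*d'≡n*d' : suc d' * γ * d' ≡ n * d'
  d*γ*d'≡n*d' = +-cancelʳ-≡ n _ _ (*-cancelˡ-≡ _ _ (suc k') (begin
    suc k' * (suc d' * γ * d' + n)           ≡⟨ bound+n≡ k' d' γ n ⟨
    bound (suc k') n γ (suc d') + n          ≡⟨ cong (_+ n) bound≡m ⟩
    m + n                                    ≡⟨ n*[d*k]≡m+n ⟨
    n * (suc d' * suc k')                    ≡⟨ n*[d*k]≡ k' d' n ⟩
    suc k' * (n * d' + n)                    ∎))
    where open ≡-Reasoning

module _ {n : ℕ} (G : Graph n) where

  N-irrefl : ∀ v → lookup (N G v) v ≡ false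
  N-irrefl v = trans (lookup∘tabulate (Adj G v) v) (irrefl G v)

  N-sym : ∀ v u → lookup (N G v) u ≡ lookup (N G u) v
  N-sym v u = trans (lookup∘tabulate (Adj G v) u) (trans (Graph.sym G v u) (sym (lookup∘tabulate (Adj G u) v)))

  𝟙-N[v] : ∀ v u → 𝟙 (lookup (N[_] G v) u) ≡ 𝟙 (lookup (N G v) u) + δ v u
  𝟙-N[v] v u
    rewrite lookup∘tabulate (λ u → Adj G v u ∨ ⌊ v ≟ u ⌋) u | lookup∘tabulate (Adj G v) u
    with v ≟ u
  ... | yes refl rewrite irrefl G v = refl
  ... | no _ with Adj G v u
  ...   | true  = refl
  ...   | false = refl

  N[v]-sym : ∀ v u → 𝟙 (lookup (N[_] G v) u) ≡ 𝟙 (lookup (N[_] G u) v)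
  N[v]-sym v u = begin
    𝟙 (lookup (N[_] G v) u)           ≡⟨ 𝟙-N[v] v u ⟩
    𝟙 (lookup (N G v) u) + δ v u      ≡⟨ cong₂ _+_ (cong 𝟙 (N-sym v u)) (δ-sym v u) ⟩
    𝟙 (lookup (N G u) v) + δ u v      ≡⟨ 𝟙-N[v] u v ⟨
    𝟙 (lookup (N[_] G u) v)           ∎
    where open ≡-Reasoning

  ∣N[v]∩p∣≡∣N∩p∣+𝟙[v∈p] : ∀ v p → ∣ N[_] G v ∩ p ∣ ≡ ∣ N G v ∩ p ∣ + 𝟙 (lookup p v)
  ∣N[v]∩p∣≡∣N∩p∣+𝟙[v∈p] v p = begin
    ∣ N[_] G v ∩ p ∣
      ≡⟨ ∣p∩q∣≡∑ (N[_] G v) p ⟩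
    ∑[ u < n ] (𝟙 (lookup (N[_] G v) u) * 𝟙 (lookup p u))
      ≡⟨ sum-cong-≗ (λ u → cong (_* 𝟙 (lookup p u)) (𝟙-N[v] v u)) ⟩
    ∑[ u < n ] ((𝟙 (lookup (N G v) u) + δ v u) * 𝟙 (lookup p u))
      ≡⟨ sum-cong-≗ (λ u → *-distribʳ-+ (𝟙 (lookup p u)) (𝟙 (lookup (N G v) u)) (δ v u)) ⟩
    ∑[ u < n ] (𝟙 (lookup (N G v) u) * 𝟙 (lookup p u) + δ v u * 𝟙 (lookup p u))
      ≡⟨ ∑-distrib-+ (λ u → 𝟙 (lookup (N G v) u) * 𝟙 (lookup p u)) (λ u → δ v u * 𝟙 (lookup p u)) ⟩
    ∑[ u < n ] (𝟙 (lookup (N G v) u) * 𝟙 (lookup p u)) + ∑[ u < n ] (δ v u * 𝟙 (lookup p u))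
      ≡⟨ cong₂ _+_ (sym (∣p∩q∣≡∑ (N G v) p)) (∑-δ v (𝟙 ∘ lookup p)) ⟩
    ∣ N G v ∩ p ∣ + 𝟙 (lookup p v)
      ∎
    where open ≡-Reasoning

  ∣N[v]∣≡deg+1 : ∀ v → ∣ N[_] G v ∣ ≡ deg G v + 1
  ∣N[v]∣≡deg+1 v = begin
    ∣ N[_] G v ∣                    ≡⟨ cong ∣_∣ (∩-identityʳ (N[_] G v)) ⟨
    ∣ N[_] G v ∩ ⊤ ∣                ≡⟨ ∣N[v]∩p∣≡∣N∩p∣+𝟙[v∈p] v ⊤ ⟩
    ∣ N G v ∩ ⊤ ∣ + 𝟙 (lookup ⊤ v)  ≡⟨ cong₂ _+_ (cong ∣_∣ (∩-identityʳ (N G v))) (cong 𝟙 (lookup-replicate v true)) ⟩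
    deg G v + 1                     ∎
    where open ≡-Reasoning

  size≡∑ : size G ≡ ∑[ v < n ] ∑[ u < n ] (𝟙 (lookup (N G v) u) * 𝟙 ⌊ v <? u ⌋)
  size≡∑ = begin
    size G                                           ≡⟨ cong ListAction.sum (map-tabulate id forward) ⟩
    ListAction.sum (List.tabulate forward)           ≡⟨ sum-tabulate forward ⟩
    ∑[ v < n ] forward v                             ≡⟨ sum-cong-≗ (λ v → ∣p∩q∣≡∑ (N G v) (later v)) ⟩
    ∑[ v < n ] ∑[ u < n ] (𝟙 (lookup (N G v) u) * 𝟙 (lookup (later v) u))
      ≡⟨ sum-cong-≗ (λ v → sum-cong-≗ λ u → cong (λ b → 𝟙 (lookup (N G v) u) * 𝟙 b) (lookup∘tabulate _ u)) ⟩
    ∑[ v < n ] ∑[ u < n ] (𝟙 (lookup (N G v) u) * 𝟙 ⌊ v <? u ⌋) ∎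
    where
    open ≡-Reasoning
    later : Fin n → Subset n
    later v = tabulate (λ u → ⌊ v <? u ⌋)
    forward : Fin n → ℕ
    forward v = ∣ N G v ∩ later v ∣

  N-split : ∀ v u → 𝟙 (lookup (N G v) u) ≡ 𝟙 (lookup (N G v) u) * 𝟙 ⌊ v <? u ⌋ + 𝟙 (lookup (N G v) u) * 𝟙 ⌊ u <? v ⌋
  N-split v u with v <? u | u <? v
  ... | yes v<u | yes u<v = contradiction u<v (<-asym v<u)
  ... | yes _   | no _    = sym (trans (cong₂ _+_ (*-identityʳ a) (*-zeroʳ a)) (+-identityʳ a))
    where a = 𝟙 (lookup (N G v) u)
  ... | no _    | yes _   = sym (cong₂ _+_ (*-zeroʳ a) (*-identityʳ a))
    where a = 𝟙 (lookup (N G v) u)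
  ... | no v≮u  | no u≮v  with <-cmp v u
  ...   | tri< v<u _ _ = contradiction v<u v≮u
  ...   | tri> _ _ u<v = contradiction u<v u≮v
  ...   | tri≈ _ refl _ rewrite N-irrefl v = refl

  ∑deg≡2m : ∑[ v < n ] deg G v ≡ 2 * size G
  ∑deg≡2m = begin
    ∑[ v < n ] deg G v
      ≡⟨ sum-cong-≗ (λ v → ∣p∣≡∑ (N G v)) ⟩
    ∑[ v < n ] ∑[ u < n ] a v u
      ≡⟨ sum-cong-≗ (λ v → sum-cong-≗ (N-split v)) ⟩
    ∑[ v < n ] ∑[ u < n ] (a v u * lt v u + a v u * lt u v)
      ≡⟨ sum-cong-≗ (λ v → ∑-distrib-+ (λ u → a v u * lt v u) (λ u → a v u * lt u v)) ⟩
    ∑[ v < n ] (∑[ u < n ] (a v u * lt v u) + ∑[ u < n ] (a v u * lt u v))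
      ≡⟨ ∑-distrib-+ (λ v → ∑[ u < n ] (a v u * lt v u)) (λ v → ∑[ u < n ] (a v u * lt u v)) ⟩
    m + ∑[ v < n ] ∑[ u < n ] (a v u * lt u v)
      ≡⟨ cong (m +_) (∑-comm (λ v u → a v u * lt u v)) ⟩
    m + ∑[ u < n ] ∑[ v < n ] (a v u * lt u v)
      ≡⟨ cong (m +_) (sum-cong-≗ λ u → sum-cong-≗ λ v → cong (λ b → 𝟙 b * lt u v) (N-sym v u)) ⟩
    m + m
      ≡⟨ cong₂ _+_ size≡∑ (trans (+-identityʳ (size G)) size≡∑) ⟨
    2 * size G
      ∎
    where
    open ≡-Reasoning
    a lt : Fin n → Fin n → ℕ
    a v u = 𝟙 (lookup (N G v) u)
    lt v u = 𝟙 ⌊ v <? u ⌋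
    m : ℕ
    m = ∑[ v < n ] ∑[ u < n ] (a v u * lt v u)

  ∑∣N[v]∣≡2m+n : ∑[ v < n ] ∣ N[_] G v ∣ ≡ 2 * size G + n
  ∑∣N[v]∣≡2m+n = begin
    ∑[ v < n ] ∣ N[_] G v ∣            ≡⟨ sum-cong-≗ ∣N[v]∣≡deg+1 ⟩
    ∑[ v < n ] (deg G v + 1)           ≡⟨ ∑-distrib-+ (deg G) (λ _ → 1) ⟩
    ∑[ v < n ] deg G v + ∑[ v < n ] 1  ≡⟨ cong₂ _+_ ∑deg≡2m (trans (∑-const n 1) (*-identityʳ n)) ⟩
    2 * size G + n                     ∎
    where open ≡-Reasoning

  ∑∣N[v]∩p∣≡∑∣N[u]∣*𝟙[u∈p] : ∀ p → ∑[ v < n ] ∣ N[_] G v ∩ p ∣ ≡ ∑[ u < n ] (∣ N[_] G u ∣ * 𝟙 (lookup p u))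
  ∑∣N[v]∩p∣≡∑∣N[u]∣*𝟙[u∈p] p = begin
    ∑[ v < n ] ∣ N[_] G v ∩ p ∣
      ≡⟨ sum-cong-≗ (λ v → ∣p∩q∣≡∑ (N[_] G v) p) ⟩
    ∑[ v < n ] ∑[ u < n ] (𝟙 (lookup (N[_] G v) u) * 𝟙 (lookup p u))
      ≡⟨ ∑-comm (λ v u → 𝟙 (lookup (N[_] G v) u) * 𝟙 (lookup p u)) ⟩
    ∑[ u < n ] ∑[ v < n ] (𝟙 (lookup (N[_] G v) u) * 𝟙 (lookup p u))
      ≡⟨ sum-cong-≗ (λ u → *-distribʳ-sum (𝟙 (lookup p u)) (λ v → 𝟙 (lookup (N[_] G v) u))) ⟨
    ∑[ u < n ] (∑[ v < n ] 𝟙 (lookup (N[_] G v) u) * 𝟙 (lookup p u))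
      ≡⟨ sum-cong-≗ (λ u → cong (_* 𝟙 (lookup p u)) (trans (sum-cong-≗ (λ v → N[v]-sym v u)) (sym (∣p∣≡∑ (N[_] G u))))) ⟩
    ∑[ u < n ] (∣ N[_] G u ∣ * 𝟙 (lookup p u))
      ∎
    where open ≡-Reasoning

  𝟙[u∈class] : ∀ {r} (c : Fin n → Fin r) i u → 𝟙 (lookup (class G c i) u) ≡ δ (c u) i
  𝟙[u∈class] c i u = cong 𝟙 (lookup∘tabulate (λ w → ⌊ c w ≟ i ⌋) u)

  ∑∣p∩class∣≡∣p∣ : ∀ {r} (c : Fin n → Fin r) p → ∑[ i < r ] ∣ p ∩ class G c i ∣ ≡ ∣ p ∣
  ∑∣p∩class∣≡∣p∣ {r} c p = begin
    ∑[ i < r ] ∣ p ∩ class G c i ∣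
      ≡⟨ sum-cong-≗ (λ i → ∣p∩q∣≡∑ p (class G c i)) ⟩
    ∑[ i < r ] ∑[ u < n ] (𝟙 (lookup p u) * 𝟙 (lookup (class G c i) u))
      ≡⟨ ∑-comm (λ i u → 𝟙 (lookup p u) * 𝟙 (lookup (class G c i) u)) ⟩
    ∑[ u < n ] ∑[ i < r ] (𝟙 (lookup p u) * 𝟙 (lookup (class G c i) u))
      ≡⟨ sum-cong-≗ (λ u → *-distribˡ-sum (𝟙 (lookup p u)) (λ i → 𝟙 (lookup (class G c i) u))) ⟨
    ∑[ u < n ] (𝟙 (lookup p u) * ∑[ i < r ] 𝟙 (lookup (class G c i) u))
      ≡⟨ sum-cong-≗ (λ u → cong (𝟙 (lookup p u) *_) (in-one-class u)) ⟩
    ∑[ u < n ] (𝟙 (lookup p u) * 1)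
      ≡⟨ sum-cong-≗ (λ u → *-identityʳ (𝟙 (lookup p u))) ⟩
    ∑[ u < n ] 𝟙 (lookup p u)
      ≡⟨ ∣p∣≡∑ p ⟨
    ∣ p ∣
      ∎
    where
    open ≡-Reasoning
    in-one-class : ∀ u → ∑[ i < r ] 𝟙 (lookup (class G c i) u) ≡ 1
    in-one-class u = trans (sum-cong-≗ (λ i → 𝟙[u∈class] c i u)) (∑-δ₁ (c u))

  ∑∣class∣≡n : ∀ {r} (c : Fin n → Fin r) → ∑[ i < r ] ∣ class G c i ∣ ≡ n
  ∑∣class∣≡n c = trans (sum-cong-≗ (λ i → cong ∣_∣ (sym (∩-identityˡ (class G c i))))) (trans (∑∣p∩class∣≡∣p∣ c ⊤) (∣⊤∣≡n n))

  regular⇒n*k≤D*∣S∣ : ∀ {k D S} → (∀ u → ∣ N[_] G u ∣ ≡ D) → IsKTupleDom G k S → n * k ≤ D * ∣ S ∣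
  regular⇒n*k≤D*∣S∣ {k} {D} {S} regular S-dom = begin
    n * k                                         ≡⟨ ∑-const n k ⟨
    ∑[ v < n ] k                                  ≤⟨ ∑-mono-≤ S-dom ⟩
    ∑[ v < n ] ∣ N[_] G v ∩ S ∣                   ≡⟨ ∑∣N[v]∩p∣≡∑∣N[u]∣*𝟙[u∈p] S ⟩
    ∑[ u < n ] (∣ N[_] G u ∣ * 𝟙 (lookup S u))    ≡⟨ sum-cong-≗ (λ u → cong (_* 𝟙 (lookup S u)) (regular u)) ⟩
    ∑[ u < n ] (D * 𝟙 (lookup S u))               ≡⟨ *-distribˡ-sum D (𝟙 ∘ lookup S) ⟨
    D * ∑[ u < n ] 𝟙 (lookup S u)                 ≡⟨ cong (D *_) (∣p∣≡∑ S) ⟨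
    D * ∣ S ∣                                     ∎
    where open ≤-Reasoning

  IsUniformPartition : ℕ → (r : ℕ) → (Fin n → Fin r) → Set
  IsUniformPartition k r c = ∀ v i → ∣ N[_] G v ∩ class G c i ∣ ≡ k

  HasEquitableUniformPartition : ℕ → Set
  HasEquitableUniformPartition k =
    ∃[ r ] Σ (Fin n → Fin r) λ c → ∃[ p ] (∀ i → ∣ class G c i ∣ ≡ p) × IsUniformPartition k r c

  module _ {k d : ℕ} {c : Fin n → Fin d} (domatic : IsKTupleDomaticPartition G k d c) where

    d*k≤∣N[v]∣ : ∀ v → d * k ≤ ∣ N[_] G v ∣
    d*k≤∣N[v]∣ v = begin
      d * k                                  ≡⟨ ∑-const d k ⟨
      ∑[ i < d ] k                           ≤⟨ ∑-mono-≤ (λ i → domatic i v) ⟩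
      ∑[ i < d ] ∣ N[_] G v ∩ class G c i ∣  ≡⟨ ∑∣p∩class∣≡∣p∣ c (N[_] G v) ⟩
      ∣ N[_] G v ∣                           ∎
      where open ≤-Reasoning

    n*[d*k]≤2m+n : n * (d * k) ≤ 2 * size G + n
    n*[d*k]≤2m+n = begin
      n * (d * k)              ≡⟨ ∑-const n (d * k) ⟨
      ∑[ v < n ] (d * k)       ≤⟨ ∑-mono-≤ d*k≤∣N[v]∣ ⟩
      ∑[ v < n ] ∣ N[_] G v ∣  ≡⟨ ∑∣N[v]∣≡2m+n ⟩
      2 * size G + n           ∎
      where open ≤-Reasoning

    d*γ≤n : ∀ {γ} → (∀ S → IsKTupleDom G k S → γ ≤ ∣ S ∣) → d * γ ≤ n
    d*γ≤n {γ} γ-min = begin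
      d * γ                         ≡⟨ ∑-const d γ ⟨
      ∑[ i < d ] γ                  ≤⟨ ∑-mono-≤ (λ i → γ-min (class G c i) (domatic i)) ⟩
      ∑[ i < d ] ∣ class G c i ∣    ≡⟨ ∑∣class∣≡n c ⟩
      n                             ∎
      where open ≤-Reasoning

    n*[d*k]≡2m+n⇒uniform : n * (d * k) ≡ 2 * size G + n → IsUniformPartition k d c
    n*[d*k]≡2m+n⇒uniform tight v i = sym (f≤g∧∑g≤∑f⇒f≗g (λ i → domatic i v) (≤-reflexive ∑∣N[v]∩class∣≡∑k) i)
      where
      d*k≡∣N[v]∣ : d * k ≡ ∣ N[_] G v ∣
      d*k≡∣N[v]∣ = f≤g∧∑g≤∑f⇒f≗g d*k≤∣N[v]∣
        (≤-reflexive (trans ∑∣N[v]∣≡2m+n (trans (sym tight) (sym (∑-const n (d * k)))))) v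
      ∑∣N[v]∩class∣≡∑k : ∑[ i < d ] ∣ N[_] G v ∩ class G c i ∣ ≡ ∑[ i < d ] k
      ∑∣N[v]∩class∣≡∑k = trans (∑∣p∩class∣≡∣p∣ c (N[_] G v)) (trans (sym d*k≡∣N[v]∣) (sym (∑-const d k)))

  d'≡0∨d*γ≡n⇒equitable : ∀ {d' γ} (c : Fin n → Fin (suc d')) → (∀ i → γ ≤ ∣ class G c i ∣) →
                          d' ≡ 0 ⊎ suc d' * γ ≡ n → ∃[ p ] (∀ i → ∣ class G c i ∣ ≡ p)
  d'≡0∨d*γ≡n⇒equitable c _ (inj₁ refl) = n , single-part
    where
    single-part : ∀ i → ∣ class G c i ∣ ≡ n
    single-part zero = trans (sym (+-identityʳ _)) (∑∣class∣≡n c)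
  d'≡0∨d*γ≡n⇒equitable {d'} {γ} c γ≤∣class∣ (inj₂ d*γ≡n) = γ , λ i → sym (f≤g∧∑g≤∑f⇒f≗g γ≤∣class∣ ∑∣class∣≤∑γ i)
    where
    ∑∣class∣≤∑γ : ∑[ i < suc d' ] ∣ class G c i ∣ ≤ ∑[ i < suc d' ] γ
    ∑∣class∣≤∑γ = ≤-reflexive (trans (∑∣class∣≡n c) (trans (sym d*γ≡n) (sym (∑-const (suc d') γ))))

  ∣N[v]∩class∣≡∣N∩class∣+δ : ∀ {r} (c : Fin n → Fin r) v j →
                             ∣ N[_] G v ∩ class G c j ∣ ≡ ∣ N G v ∩ class G c j ∣ + δ (c v) j
  ∣N[v]∩class∣≡∣N∩class∣+δ c v j =
    trans (∣N[v]∩p∣≡∣N∩p∣+𝟙[v∈p] v (class G c j)) (cong (∣ N G v ∩ class G c j ∣ +_) (𝟙[u∈class] c j v))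

  InPsi⇔HasEquitableUniformPartition : ∀ {k'} → InPsi G (suc k') ⇔ HasEquitableUniformPartition (suc k')
  InPsi⇔HasEquitableUniformPartition {k'} = mk⇔ to from
    where
    to : InPsi G (suc k') → HasEquitableUniformPartition (suc k')
    to (r , c , p , sizes , inside , outside) = r , c , p , sizes , uniform
      where
      uniform : IsUniformPartition (suc k') r c
      uniform v j with j ≟ c v
      ... | yes refl = trans (∣N[v]∩class∣≡∣N∩class∣+δ c v j) (trans (cong₂ _+_ (inside v) (δ-refl (c v))) (+-comm k' 1))
      ... | no j≢cv  = trans (∣N[v]∩class∣≡∣N∩class∣+δ c v j)
                             (trans (cong₂ _+_ (outside v j j≢cv) (δ-≢ (j≢cv ∘ sym))) (+-identityʳ (suc k')))

    from : HasEquitableUniformPartition (suc k') → InPsi G (suc k')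
    from (r , c , p , sizes , uniform) = r , c , p , sizes , inside , outside
      where
      inside : ∀ v → ∣ N G v ∩ class G c (c v) ∣ ≡ k'
      inside v = +-cancelʳ-≡ 1 _ _ (begin
        ∣ N G v ∩ class G c (c v) ∣ + 1            ≡⟨ cong (∣ N G v ∩ class G c (c v) ∣ +_) (δ-refl (c v)) ⟨
        ∣ N G v ∩ class G c (c v) ∣ + δ (c v) (c v) ≡⟨ ∣N[v]∩class∣≡∣N∩class∣+δ c v (c v) ⟨
        ∣ N[_] G v ∩ class G c (c v) ∣              ≡⟨ uniform v (c v) ⟩
        suc k'                                      ≡⟨ +-comm 1 k' ⟩
        k' + 1                                      ∎)
        where open ≡-Reasoning
      outside : ∀ v j → ¬ (j ≡ c v) → ∣ N G v ∩ class G c j ∣ ≡ suc k'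
      outside v j j≢cv = begin
        ∣ N G v ∩ class G c j ∣               ≡⟨ +-identityʳ _ ⟨
        ∣ N G v ∩ class G c j ∣ + 0           ≡⟨ cong (∣ N G v ∩ class G c j ∣ +_) (δ-≢ (j≢cv ∘ sym)) ⟨
        ∣ N G v ∩ class G c j ∣ + δ (c v) j   ≡⟨ ∣N[v]∩class∣≡∣N∩class∣+δ c v j ⟨
        ∣ N[_] G v ∩ class G c j ∣            ≡⟨ uniform v j ⟩
        suc k'                                ∎
        where open ≡-Reasoning

  module _ {k r p : ℕ} {c : Fin n → Fin r} (sizes : ∀ i → ∣ class G c i ∣ ≡ p)
           (uniform : IsUniformPartition k r c) where

    uniform⇒domatic : IsKTupleDomaticPartition G k r c
    uniform⇒domatic i v = ≤-reflexive (sym (uniform v i))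

    uniform⇒∣N[v]∣≡r*k : ∀ v → ∣ N[_] G v ∣ ≡ r * k
    uniform⇒∣N[v]∣≡r*k v = trans (sym (∑∣p∩class∣≡∣p∣ c (N[_] G v))) (trans (sum-cong-≗ (uniform v)) (∑-const r k))

    uniform⇒n*[r*k]≡2m+n : n * (r * k) ≡ 2 * size G + n
    uniform⇒n*[r*k]≡2m+n = begin
      n * (r * k)              ≡⟨ ∑-const n (r * k) ⟨
      ∑[ v < n ] (r * k)       ≡⟨ sum-cong-≗ (sym ∘ uniform⇒∣N[v]∣≡r*k) ⟩
      ∑[ v < n ] ∣ N[_] G v ∣  ≡⟨ ∑∣N[v]∣≡2m+n ⟩
      2 * size G + n           ∎
      where open ≡-Reasoning

    r*p≡n : r * p ≡ n
    r*p≡n = trans (sym (∑-const r p)) (trans (sum-cong-≗ (sym ∘ sizes)) (∑∣class∣≡n c))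

    p≤∣S∣ : .{{_ : NonZero (r * k)}} → ∀ {S} → IsKTupleDom G k S → p ≤ ∣ S ∣
    p≤∣S∣ {S} S-dom = *-cancelʳ-≤ p ∣ S ∣ (r * k) (begin
      p * (r * k)     ≡⟨ trans (sym (*-assoc p r k)) (cong (_* k) (*-comm p r)) ⟩
      r * p * k       ≡⟨ cong (_* k) r*p≡n ⟩
      n * k           ≤⟨ regular⇒n*k≤D*∣S∣ uniform⇒∣N[v]∣≡r*k S-dom ⟩
      r * k * ∣ S ∣   ≡⟨ *-comm (r * k) ∣ S ∣ ⟩
      ∣ S ∣ * (r * k) ∎)
      where open ≤-Reasoning

    r≡d : ∀ {d} .{{_ : NonZero k}} → 1 ≤ n → IsKTupleDomaticNumber G k d → r ≡ d
    r≡d {d} 1≤n ((_ , domatic) , d-max) = ≤-antisym (d-max r c uniform⇒domatic) (*-cancelʳ-≤ d r k d*k≤r*k)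
      where
      v₀ = fromℕ< 1≤n
      d*k≤r*k : d * k ≤ r * k
      d*k≤r*k = ≤-trans (d*k≤∣N[v]∣ domatic v₀) (≤-reflexive (uniform⇒∣N[v]∣≡r*k v₀))

    γ≡p : ∀ {γ} .{{_ : NonZero (r * k)}} → 1 ≤ n → IsKTupleDomNumber G k γ → γ ≡ p
    γ≡p {γ} 1≤n ((S , S-dom , ∣S∣≡γ) , γ-min) = ≤-antisym γ≤p (subst (p ≤_) ∣S∣≡γ (p≤∣S∣ S-dom))
      where
      v₀ = fromℕ< 1≤n
      γ≤p : γ ≤ p
      γ≤p = subst (γ ≤_) (sizes (c v₀)) (γ-min (class G c (c v₀)) (uniform⇒domatic (c v₀)))

theorem7 : (k n : ℕ) → 1 ≤ k → 1 ≤ n → (G : Graph n) → MinDegAtLeast G (k ∸ 1)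
         → (γ d : ℕ) → IsKTupleDomNumber G k γ → IsKTupleDomaticNumber G k d
         → (k * γ * (d * (d ∸ 1)) + (k ∸ 1) * n ≤ 2 * size G)
           × ((k * γ * (d * (d ∸ 1)) + (k ∸ 1) * n ≡ 2 * size G) ⇔ InPsi G k)
theorem7 (suc k') n _ 1≤n G _ γ zero _ ((c , _) , _) = contradiction (c (fromℕ< 1≤n)) ¬Fin0
theorem7 (suc k') n _ 1≤n G _ γ (suc d') γ-number@(_ , γ-min) d-number@((c , domatic) , _) =
  bound≤m k' d' γ n (2 * size G) dγ≤n ndk≤2m+n , mk⇔ tight⇒Ψ Ψ⇒tight
  where
  dγ≤n = d*γ≤n G domatic γ-min
  ndk≤2m+n = n*[d*k]≤2m+n G domatic

  tight⇒Ψ : bound (suc k') n γ (suc d') ≡ 2 * size G → InPsi G (suc k')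
  tight⇒Ψ bound≡2m with bound≡m⇒tight k' d' γ n (2 * size G) dγ≤n ndk≤2m+n bound≡2m
  ... | n*[d*k]≡2m+n , single-or-tight with d'≡0∨d*γ≡n⇒equitable G c (λ i → γ-min _ (domatic i)) single-or-tight
  ... | p , sizes = Equivalence.from (InPsi⇔HasEquitableUniformPartition G)
                      (suc d' , c , p , sizes , n*[d*k]≡2m+n⇒uniform G domatic n*[d*k]≡2m+n)

  Ψ⇒tight : InPsi G (suc k') → bound (suc k') n γ (suc d') ≡ 2 * size G
  Ψ⇒tight ψ with Equivalence.to (InPsi⇔HasEquitableUniformPartition G) ψ
  ... | r , _ , p , sizes , uniform with r≡d G sizes uniform 1≤n d-number
  ... | refl = +-cancelʳ-≡ n _ _ (trans (d*γ≡n⇒bound+n≡n*[d*k] k' d' γ n d*γ≡n) (uniform⇒n*[r*k]≡2m+n G sizes uniform))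
    where
    d*γ≡n : suc d' * γ ≡ n
    d*γ≡n = trans (cong (suc d' *_) (γ≡p G sizes uniform 1≤n γ-number)) (r*p≡n G sizes uniform)
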